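{- Let $T=(D,\mathcal{L})$ be a northeast tableau, and let $D_0=\{(i,c): i\in C_c\}$, where $C_c$ is the set of labels of $\mathcal{L}$ in column $c$ (so $D_0$ with its super-standard labeling is the initial northeast tableau of $T$). If $D'$ is a diagram obtained by performing a single Kohnert move on $D$, then the standard labeling $\mathcal{L}'$ of $D'$ with respect to $D_0$, namely the unique strict labeling of $D'$ whose set of labels in each column $c$ is $C_c$, is a northeast labeling.
   Context: A diagram is a finite subset of $\mathbb{N}\times\mathbb{N}$; $(r,c)$ is a cell in row $r$, column $c$, rows numbered bottom to top. A Kohnert move on $D$ takes the rightmost cell $(r,c)$ of some row and moves it to $(r',c)$, $r'$ the largest $1\le r'<r$ with $(r',c)\notin D$ (no move if none). A labeling is a map $\mathcal{L}:D\to\mathbb{N}$; strict if labels strictly increase bottom to top in each column; super-standard if each cell is labeled by its row index. A northeast labeling satisfies: (1) strict; (2) each label in row $i$ is at least $i$; (3) if $x'$ is in a column strictly right of $x$ and $\mathcal{L}(x')<\mathcal{L}(x)$, then some cell $x''$ in the column of $x'$ has $\mathcal{L}(x'')=\mathcal{L}(x)$; (4) if $x'$ is in a column strictly right of $x$ and $\mathcal{L}(x')=\mathcal{L}(x)$, then $x'$ is weakly below $x$. A northeast tableau is a pair $(D,\mathcal{L})$ with $\mathcal{L}$ a northeast labeling of $D$. -}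

module Defs where

open import Data.Nat using (ℕ; _≤_; _<_)
open import Data.Product using (_×_; _,_; Σ; ∃; proj₁; proj₂)
open import Data.Sum using (_⊎_)
open import Data.List using (List)
open import Data.List.Membership.Propositional using (_∈_; _∉_)
open import Relation.Binary.PropositionalEquality using (_≡_; _≢_)
open import Function.Bundles using (_⇔_)

-- A cell (r , c): row r (numbered bottom to top, starting at 1), column c.
Cell : Set
Cell = ℕ × ℕ

row : Cell → ℕ
row = proj₁

col : Cell → ℕ
col = proj₂

-- A diagram is a finite subset of ℕ × ℕ, represented by a list of its cells
-- (only membership matters).
Diagram : Set
Diagram = List Cell

-- Rows are positive integers (paper's ℕ = {1,2,...}).
RowsPositive : Diagram → Set
RowsPositive D = ∀ x → x ∈ D → 1 ≤ row x

SameCells : Diagram → Diagram → Set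
SameCells D E = ∀ x → (x ∈ D) ⇔ (x ∈ E)

KohnertMove : Diagram → Diagram → Set
KohnertMove D D' =
  Σ ℕ λ r → Σ ℕ λ c → Σ ℕ λ r' →
    ((r , c) ∈ D)
  × (∀ c' → (r , c') ∈ D → c' ≤ c)
  × (1 ≤ r') × (r' < r)
  × ((r' , c) ∉ D)
  × (∀ r'' → r' < r'' → r'' < r → (r'' , c) ∈ D)
  × (∀ x → (x ∈ D') ⇔ (((x ∈ D) × (x ≢ (r , c))) ⊎ (x ≡ (r' , c))))

-- A labeling (only its values on the cells of the diagram matter).
Labeling : Set
Labeling = Cell → ℕ

Strict : Diagram → Labeling → Set
Strict D L = ∀ x y → x ∈ D → y ∈ D → col x ≡ col y → row x < row y → L x < L y

LabelInColumn : Diagram → Labeling → ℕ → ℕ → Set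
LabelInColumn D L c n = ∃ λ x → (x ∈ D) × (col x ≡ c) × (L x ≡ n)

-- Northeast labeling, conditions (1)-(4).
Northeast : Diagram → Labeling → Set
Northeast D L =
    Strict D L
  × (∀ x → x ∈ D → row x ≤ L x)
  × (∀ x x' → x ∈ D → x' ∈ D → col x < col x' → L x' < L x →
       ∃ λ x'' → (x'' ∈ D) × (col x'' ≡ col x') × (L x'' ≡ L x))
  × (∀ x x' → x ∈ D → x' ∈ D → col x < col x' → L x' ≡ L x → row x' ≤ row x)

-- L' is a strict labeling of D' whose set of labels in each column c equals
-- the set C_c of labels of L (on D) in column c: the standard labeling of D'
-- with respect to D₀ = {(i , c) : i ∈ C_c}.
StandardWrt : Diagram → Labeling → Diagram → Labeling → Set
StandardWrt D L D' L' =
    Strict D' L'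
  × (∀ c n → LabelInColumn D' L' c n ⇔ LabelInColumn D L c n)

-- A Kohnert move on column c amounts, column-wise, to lowering the cells in rows r' + 1 , … , r
-- by one row.  Undoing this is a column- and order-preserving bijection D' → D, and since a
-- strict labeling is determined by its column label sets, the standard labeling of D' is L
-- transported along it.  Conditions (1) and (3) depend only on strictness and the column label
-- sets, and (2) survives because the transport only raises cells.
-- Condition (4) could only fail for a lowered cell (i , c) and a cell (i + 1 , b), b > c, with the
-- same label; conditions (3) and (4) of L push such an equality up column b, alongside the
-- filled part of column c, to row r, producing a cell right of the moved (rightmost) cell.

module Submission where

open import Defs
open import Data.Product using (_×_; Σ; _,_; ∃; proj₁; proj₂)
open import Data.Product.Properties using (×-≡,≡→≡)
open import Data.Sum using (_⊎_; inj₁; inj₂)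
open import Data.Nat using (ℕ; suc; _≤_; _<_; _≤′_; ≤′-reflexive; ≤′-step; _≟_; _≤?_; _<?_; s≤s)
open import Data.Nat.Properties
open import Data.Nat.Induction using (<-wellFounded)
open import Induction.WellFounded using (Acc; acc)
open import Data.Empty using (⊥-elim)
open import Data.List.Membership.Propositional using (_∈_; _∉_)
open import Relation.Nullary using (¬_; yes; no)
open import Relation.Nullary.Decidable using (_×-dec_)
open import Relation.Unary using (Decidable)
open import Relation.Binary.PropositionalEquality using (_≡_; _≢_; refl; sym; trans; subst; subst₂)
open import Relation.Binary using (tri<; tri≈; tri>)
open import Function using (_∘_)
open import Function.Bundles using (_⇔_; mk⇔; Equivalence)
open import Function.Construct.Composition using (_⇔-∘_)
open import Function.Construct.Symmetry using (⇔-sym)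
open Equivalence using (to; from)

ColumnLabelsAgree : Diagram → Labeling → Diagram → Labeling → Set
ColumnLabelsAgree D L E M = ∀ c n → LabelInColumn D L c n ⇔ LabelInColumn E M c n

RowBounded : Diagram → Labeling → Set
RowBounded D L = ∀ x → x ∈ D → row x ≤ L x

LabelReappearsRight : Diagram → Labeling → Set
LabelReappearsRight D L = ∀ x x' → x ∈ D → x' ∈ D → col x < col x' → L x' < L x →
  ∃ λ x'' → (x'' ∈ D) × (col x'' ≡ col x') × (L x'' ≡ L x)

EqualLabelsWeaklyFall : Diagram → Labeling → Set
EqualLabelsWeaklyFall D L = ∀ x x' → x ∈ D → x' ∈ D → col x < col x' → L x' ≡ L x →
  row x' ≤ row x

strict-reflects-< : ∀ {D L} → Strict D L → ∀ {x y} → x ∈ D → y ∈ D → col x ≡ col y →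
  L x < L y → row x < row y
strict-reflects-< strict {x} {y} x∈ y∈ same-col Lx<Ly with <-cmp (row x) (row y)
... | tri< rx<ry _ _ = rx<ry
... | tri≈ _ same-row _ with ×-≡,≡→≡ {p₁ = x} {p₂ = y} (same-row , same-col)
...   | refl = ⊥-elim (<-irrefl refl Lx<Ly)
strict-reflects-< strict {x} {y} x∈ y∈ same-col Lx<Ly | tri> _ _ ry<rx =
  ⊥-elim (<-asym Lx<Ly (strict y x y∈ x∈ (sym same-col) ry<rx))

-- If L₁ x < L₂ x, then under L₂ the label L₁ x sits strictly below x, where L₁ and L₂ agree.
label-not-below : ∀ {D L₁ L₂} → Strict D L₁ → Strict D L₂ →
  (∀ c n → LabelInColumn D L₁ c n → LabelInColumn D L₂ c n) →
  ∀ {x} → x ∈ D → (∀ y → y ∈ D → row y < row x → L₁ y ≡ L₂ y) → ¬ L₁ x < L₂ x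
label-not-below {L₁ = L₁} {L₂} strict₁ strict₂ labels₁⊆₂ {x} x∈ agree-below L₁x<L₂x
  with labels₁⊆₂ (col x) (L₁ x) (x , x∈ , refl , refl)
... | y , y∈ , same-col , L₂y≡L₁x =
  let ry<rx = strict-reflects-< strict₂ y∈ x∈ same-col (subst (_< L₂ x) (sym L₂y≡L₁x) L₁x<L₂x)
  in <-irrefl (trans (agree-below y y∈ ry<rx) L₂y≡L₁x) (strict₁ y x y∈ x∈ same-col ry<rx)

strict-labeling-unique : ∀ {D L₁ L₂} → Strict D L₁ → Strict D L₂ → ColumnLabelsAgree D L₁ D L₂ →
  ∀ x → x ∈ D → L₁ x ≡ L₂ x
strict-labeling-unique {D} {L₁} {L₂} strict₁ strict₂ agree x = go x (<-wellFounded (row x))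
  where
  go : ∀ x → Acc _<_ (row x) → x ∈ D → L₁ x ≡ L₂ x
  go x (acc below) x∈ = ≤-antisym
    (≮⇒≥ (label-not-below strict₂ strict₁ (λ c n → from (agree c n)) x∈
            (λ y y∈ ry<rx → sym (go y (below ry<rx) y∈))))
    (≮⇒≥ (label-not-below strict₁ strict₂ (λ c n → to (agree c n)) x∈
            (λ y y∈ ry<rx → go y (below ry<rx) y∈)))

LabelReappearsRight-transport : ∀ {D L E M} → ColumnLabelsAgree D L E M →
  LabelReappearsRight E M → LabelReappearsRight D L
LabelReappearsRight-transport {L = L} agree reappears x x' x∈ x'∈ x<x' Lx'<Lx
  with to (agree (col x) (L x)) (x , x∈ , refl , refl)
     | to (agree (col x') (L x')) (x' , x'∈ , refl , refl)
... | y , y∈ , y-col , y-label | y' , y'∈ , y'-col , y'-label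
  with reappears y y' y∈ y'∈ (subst₂ _<_ (sym y-col) (sym y'-col) x<x')
                              (subst₂ _<_ (sym y'-label) (sym y-label) Lx'<Lx)
... | z , z∈ , z-col , z-label =
  from (agree (col x') (L x)) (z , z∈ , trans z-col y'-col , trans z-label y-label)

record ColumnOrderSurjection (D' D : Diagram) (φ : Cell → Cell) : Set where
  field
    maps-into : ∀ x → x ∈ D' → φ x ∈ D
    preserves-col : ∀ x → col (φ x) ≡ col x
    preserves-row-order : ∀ x y → x ∈ D' → y ∈ D' → col x ≡ col y → row x < row y →
      row (φ x) < row (φ y)
    onto : ∀ y → y ∈ D → ∃ λ x → x ∈ D' × φ x ≡ y

module _ {D' D φ} (φ-surj : ColumnOrderSurjection D' D φ) where
  open ColumnOrderSurjection φ-surj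

  pullback-strict : ∀ {L} → Strict D L → Strict D' (L ∘ φ)
  pullback-strict strict x y x∈ y∈ same-col rx<ry =
    strict (φ x) (φ y) (maps-into x x∈) (maps-into y y∈)
      (trans (preserves-col x) (trans same-col (sym (preserves-col y))))
      (preserves-row-order x y x∈ y∈ same-col rx<ry)

  pullback-column-labels : ∀ {L} → ColumnLabelsAgree D' (L ∘ φ) D L
  pullback-column-labels {L} c n = mk⇔
    (λ { (x , x∈ , refl , refl) → φ x , maps-into x x∈ , preserves-col x , refl })
    (λ { (y , y∈ , refl , refl) → case-onto y (onto y y∈) })
    where
    case-onto : ∀ y → (∃ λ x → x ∈ D' × φ x ≡ y) → LabelInColumn D' (L ∘ φ) (col y) (L y)
    case-onto .(φ x) (x , x∈ , refl) = x , x∈ , sym (preserves-col x) , refl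

-- The cell above (j , c) has a larger label, which must reappear in column b, and conditions
-- (1) and (4) pin that reappearance to row suc j.
equal-label-climbs-one-row : ∀ {D L} → Northeast D L → ∀ {b c j} → c < b →
  (j , c) ∈ D → (suc j , c) ∈ D → (j , b) ∈ D →
  L (j , b) ≡ L (j , c) → (suc j , b) ∈ D × L (suc j , b) ≡ L (suc j , c)
equal-label-climbs-one-row {L = L} (strict , _ , reappears , falls) {b} {c} {j}
  c<b jc∈ sjc∈ jb∈ same-label
  with Ljb<Lsjc ← subst (_< L (suc j , c)) (sym same-label) (strict _ _ jc∈ sjc∈ refl (n<1+n j))
  with reappears (suc j , c) (j , b) sjc∈ jb∈ c<b Ljb<Lsjc
... | (i , .b) , y∈ , refl , y-label
  with ≤-antisym (falls (suc j , c) (i , b) sjc∈ y∈ c<b y-label)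
                 (strict-reflects-< strict jb∈ y∈ refl (subst (L (j , b) <_) (sym y-label) Ljb<Lsjc))
... | refl = y∈ , y-label

equal-label-climbs : ∀ {D L} → Northeast D L → ∀ {b c j k} → c < b → j ≤′ k →
  (∀ m → j ≤ m → m ≤ k → (m , c) ∈ D) → (j , b) ∈ D →
  L (j , b) ≡ L (j , c) → (k , b) ∈ D × L (k , b) ≡ L (k , c)
equal-label-climbs _ _ (≤′-reflexive refl) _ jb∈ same-label = jb∈ , same-label
equal-label-climbs northeast c<b (≤′-step {k} j≤′k) column-c-filled jb∈ same-label
  with j≤k ← ≤′⇒≤ j≤′k
  with kb∈ , same-label-k ← equal-label-climbs northeast c<b j≤′k
         (λ m j≤m m≤k → column-c-filled m j≤m (m≤n⇒m≤1+n m≤k)) jb∈ same-label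
  = equal-label-climbs-one-row northeast c<b (column-c-filled k j≤k (n≤1+n k))
      (column-c-filled (suc k) (m≤n⇒m≤1+n j≤k) ≤-refl) kb∈ same-label-k

module KohnertMoveRelabelling
  {D D' : Diagram} {r c r' : ℕ}
  (rc∈D : (r , c) ∈ D) (rightmost : ∀ c' → (r , c') ∈ D → c' ≤ c)
  (r'<r : r' < r) (r'c∉D : (r' , c) ∉ D)
  (between∈D : ∀ m → r' < m → m < r → (m , c) ∈ D)
  (D'-cells : ∀ x → (x ∈ D') ⇔ (((x ∈ D) × (x ≢ (r , c))) ⊎ (x ≡ (r' , c))))
  where

  column-c-filled : ∀ m → r' < m → m ≤ r → (m , c) ∈ D
  column-c-filled m r'<m m≤r with m≤n⇒m<n∨m≡n m≤r
  ... | inj₁ m<r = between∈D m r'<m m<r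
  ... | inj₂ refl = rc∈D

  rc∉D' : (r , c) ∉ D'
  rc∉D' rc∈D' with to (D'-cells (r , c)) rc∈D'
  ... | inj₁ (_ , rc≢rc) = rc≢rc refl
  ... | inj₂ refl = <-irrefl refl r'<r

  Lowered : Cell → Set
  Lowered (i , b) = b ≡ c × r' ≤ i × i < r

  lowered? : Decidable Lowered
  lowered? (i , b) = (b ≟ c) ×-dec (r' ≤? i) ×-dec (i <? r)

  unmove : Cell → Cell
  unmove (i , b) with lowered? (i , b)
  ... | yes _ = (suc i , b)
  ... | no _ = (i , b)

  unmove-col : ∀ x → col (unmove x) ≡ col x
  unmove-col (i , b) with lowered? (i , b)
  ... | yes _ = refl
  ... | no _ = refl

  row≤unmove-row : ∀ x → row x ≤ row (unmove x)
  row≤unmove-row (i , b) with lowered? (i , b)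
  ... | yes _ = n≤1+n i
  ... | no _ = ≤-refl

  unmove-∈ : ∀ x → x ∈ D' → unmove x ∈ D
  unmove-∈ (i , b) x∈ with lowered? (i , b)
  ... | yes (refl , r'≤i , i<r) = column-c-filled (suc i) (s≤s r'≤i) i<r
  ... | no not-lowered with to (D'-cells (i , b)) x∈
  ...   | inj₁ (x∈D , _) = x∈D
  ...   | inj₂ refl = ⊥-elim (not-lowered (refl , ≤-refl , r'<r))

  unmove-preserves-row-order : ∀ x y → x ∈ D' → y ∈ D' → col x ≡ col y → row x < row y →
    row (unmove x) < row (unmove y)
  unmove-preserves-row-order (i , b) (j , .b) x∈ y∈ refl i<j with lowered? (i , b) | lowered? (j , b)
  ... | yes _ | yes _ = s≤s i<j
  ... | no _ | no _ = i<j
  ... | no _ | yes _ = m<n⇒m<1+n i<j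
  ... | yes (refl , r'≤i , i<r) | no not-lowered = ≤-<-trans i<r (≤∧≢⇒< r≤j r≢j)
    where
    r≤j : r ≤ j
    r≤j = ≮⇒≥ (λ j<r → not-lowered (refl , ≤-trans r'≤i (<⇒≤ i<j) , j<r))
    r≢j : r ≢ j
    r≢j refl = rc∉D' y∈

  lowered-∈ : ∀ {k} → r' ≤ k → k < r → (k , c) ∈ D'
  lowered-∈ r'≤k k<r with m≤n⇒m<n∨m≡n r'≤k
  ... | inj₁ r'<k = from (D'-cells _) (inj₁ (between∈D _ r'<k k<r , λ { refl → <-irrefl refl k<r }))
  ... | inj₂ refl = from (D'-cells _) (inj₂ refl)

  unmove-onto : ∀ y → y ∈ D → ∃ λ x → x ∈ D' × unmove x ≡ y
  unmove-onto (j , b) y∈ with (b ≟ c) ×-dec (r' <? j) ×-dec (j ≤? r)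
  unmove-onto (suc k , b) y∈ | yes (refl , s≤s r'≤k , sk≤r) = (k , c) , lowered-∈ r'≤k sk≤r , unmove-kc
    where
    unmove-kc : unmove (k , c) ≡ (suc k , c)
    unmove-kc with lowered? (k , c)
    ... | yes _ = refl
    ... | no not-lowered = ⊥-elim (not-lowered (refl , r'≤k , sk≤r))
  ... | no not-raised =
    (j , b) , from (D'-cells _) (inj₁ (y∈ , λ { refl → not-raised (refl , r'<r , ≤-refl) })) , unmove-jb
    where
    unmove-jb : unmove (j , b) ≡ (j , b)
    unmove-jb with lowered? (j , b)
    ... | no _ = refl
    ... | yes (refl , r'≤j , j<r) = ⊥-elim (not-raised (refl , ≤∧≢⇒< r'≤j r'≢j , <⇒≤ j<r))
      where
      r'≢j : r' ≢ j
      r'≢j refl = r'c∉D y∈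

  unmove-surjection : ColumnOrderSurjection D' D unmove
  unmove-surjection = record
    { maps-into = unmove-∈
    ; preserves-col = unmove-col
    ; preserves-row-order = unmove-preserves-row-order
    ; onto = unmove-onto
    }

  no-equal-label-right-of-moved-column : ∀ {L} → Northeast D L → ∀ {b j} → c < b → r' < j → j ≤ r →
    (j , b) ∈ D → L (j , b) ≢ L (j , c)
  no-equal-label-right-of-moved-column northeast c<b r'<j j≤r jb∈ same-label =
    <⇒≱ c<b (rightmost _ (proj₁ (equal-label-climbs northeast c<b (≤⇒≤′ j≤r)
      (λ m j≤m m≤r → column-c-filled m (<-≤-trans r'<j j≤m) m≤r) jb∈ same-label)))

  unmove-falls : ∀ {L} → Northeast D L → EqualLabelsWeaklyFall D' (L ∘ unmove)
  unmove-falls {L} northeast@(_ , _ , _ , falls) x x' x∈ x'∈ x<x' same-label =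
    rows-fall x x' (unmove-∈ x' x'∈) x<x' same-label
      (falls (unmove x) (unmove x') (unmove-∈ x x∈) (unmove-∈ x' x'∈)
        (subst₂ _<_ (sym (unmove-col x)) (sym (unmove-col x')) x<x') same-label)
    where
    rows-fall : ∀ x x' → unmove x' ∈ D → col x < col x' → L (unmove x') ≡ L (unmove x) →
      row (unmove x') ≤ row (unmove x) → row x' ≤ row x
    rows-fall (i , b) x' _ _ _ fell with lowered? (i , b)
    ... | no _ = ≤-trans (row≤unmove-row x') fell
    rows-fall (i , b) (i' , b') x'∈D c<b' same-label fell | yes (refl , r'≤i , i<r)
      with lowered? (i' , b')
    ... | yes (refl , _) = ⊥-elim (<-irrefl refl c<b')
    ... | no _ with m≤n⇒m<n∨m≡n fell
    ...   | inj₁ i'<1+i = ≤-pred i'<1+i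
    ...   | inj₂ refl =
      ⊥-elim (no-equal-label-right-of-moved-column northeast c<b' (s≤s r'≤i) i<r x'∈D same-label)

  unmove-standard : ∀ {L} → Strict D L → StandardWrt D L D' (L ∘ unmove)
  unmove-standard strict =
    pullback-strict unmove-surjection strict , pullback-column-labels unmove-surjection

  standard-northeast : ∀ {L L'} → Northeast D L → StandardWrt D L D' L' → Northeast D' L'
  standard-northeast {L} {L'} northeast@(strict , bounded , reappears , _) (strict' , labels') =
    strict' , bounded' , LabelReappearsRight-transport labels' reappears , falls'
    where
    L'≗L∘unmove : ∀ x → x ∈ D' → L' x ≡ L (unmove x)
    L'≗L∘unmove = strict-labeling-unique strict' (proj₁ (unmove-standard strict))
      (λ c n → ⇔-sym (proj₂ (unmove-standard strict) c n) ⇔-∘ labels' c n)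

    bounded' : RowBounded D' L'
    bounded' x x∈ = subst (row x ≤_) (sym (L'≗L∘unmove x x∈))
      (≤-trans (row≤unmove-row x) (bounded (unmove x) (unmove-∈ x x∈)))

    falls' : EqualLabelsWeaklyFall D' L'
    falls' x x' x∈ x'∈ x<x' same-label = unmove-falls northeast x x' x∈ x'∈ x<x'
      (trans (sym (L'≗L∘unmove x' x'∈)) (trans same-label (L'≗L∘unmove x x∈)))

lemma2p13 : (D : Diagram) → (L : Labeling) → RowsPositive D → Northeast D L →
    (D' : Diagram) → KohnertMove D D' →
    (Σ Labeling λ L' → StandardWrt D L D' L')
    × ((L' : Labeling) → StandardWrt D L D' L' → Northeast D' L')
lemma2p13 D L _ northeast D'
  (_ , _ , _ , rc∈D , rightmost , _ , r'<r , r'c∉D , between∈D , D'-cells) =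
  (L ∘ unmove , unmove-standard (proj₁ northeast)) , λ L' → standard-northeast northeast
  where
  open KohnertMoveRelabelling rc∈D rightmost r'<r r'c∉D between∈D D'-cells
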